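{- The class of all finite digraphs that contain a directed cycle is decided by an adaptive left $2$-query algorithm over $\mathbb{N}$, but not by any non-adaptive left $k$-query algorithm over $\mathbb{N}$, for any $k$.
   Context: Digraphs are finite structures $(V,R)$, $V\ne\varnothing$, $R\subseteq V\times V$; a directed cycle is a sequence of distinct vertices $a_0,\dots,a_{\ell-1}$ ($\ell\ge1$) with $(a_i,a_{i+1})\in R$ for $i<\ell-1$ and $(a_{\ell-1},a_0)\in R$. $\mathsf{FIN}$ is the class of all digraphs, $\hom(F,A)$ the number of homomorphisms $F\to A$. A non-adaptive left $k$-query algorithm over $\mathbb{N}$ is a pair $((F_1,\dots,F_k),X)$ with $F_i\in\mathsf{FIN}$, $X\subseteq\mathbb{N}^k$, deciding $\{D:(\hom(F_i,D))_{i=1}^k\in X\}$. For a set $\Sigma$, $\Sigma^{<\omega}$ is the set of finite strings over $\Sigma$; a subtree is a prefix-closed subset, a leaf an element with no proper extension. An adaptive left query algorithm over $\mathbb{N}$ is a function $G:\mathcal{T}\to\mathsf{FIN}\cup\{\mathsf{YES},\mathsf{NO}\}$, $\mathcal{T}\subseteq\mathbb{N}^{<\omega}$ a subtree, $G(\sigma)\in\{\mathsf{YES},\mathsf{NO}\}$ iff $\sigma$ is a leaf; its computation path on $A$ is the limit of $\sigma_0=\varepsilon$, $\sigma_{i+1}=\sigma_i$ if $G(\sigma_i)\in\{\mathsf{YES},\mathsf{NO}\}$, else $\sigma_{i+1}=\sigma_i\bullet\hom(G(\sigma_i),A)$; it must halt on all inputs and decides $\{A:G(\text{path of }A)=\mathsf{YES}\}$.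 It is an adaptive left $k$-query algorithm if all computation paths have length at most $k$. -}

module Defs where

open import Data.Nat using (ℕ; zero; suc; _≤_)
open import Data.Bool using (Bool; true; false; _∧_; _∨_; not)
open import Data.Fin using (Fin; zero; suc; inject₁; fromℕ)
open import Data.Vec using (Vec; []; _∷_; lookup)
open import Data.List using (List; []; _∷_; [_]; _++_; map; concatMap; length; filter; foldr; allFin; cartesianProduct)
open import Data.List.Relation.Unary.Any using ()
open import Data.Maybe using (Maybe; just; nothing)
open import Data.Product using (Σ; _×_; _,_; proj₁; proj₂)
open import Function.Definitions using (Injective)
open import Relation.Binary.PropositionalEquality using (_≡_)
open import Function.Bundles using (_⇔_)

-- A finite digraph (V , R): V = Fin (suc n) (non-empty),
-- R given by its (decidable) characteristic function.
record Digraph : Set where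
  constructor digraph
  field
    size : ℕ
    edge : Fin (suc size) → Fin (suc size) → Bool

open Digraph public

Vertex : Digraph → Set
Vertex D = Fin (suc (size D))

_∶_⟶_ : (D : Digraph) → Vertex D → Vertex D → Set
D ∶ a ⟶ b = edge D a b ≡ true

HasDirectedCycle : Digraph → Set
HasDirectedCycle D =
  Σ ℕ λ ℓ → Σ (Fin (suc ℓ) → Vertex D) λ a →
    Injective _≡_ _≡_ a
    × ((i : Fin ℓ) → D ∶ a (inject₁ i) ⟶ a (suc i))
    × (D ∶ a (fromℕ ℓ) ⟶ a zero)

allMaps : (m n : ℕ) → List (Vec (Fin n) m)
allMaps zero    n = [ [] ]
allMaps (suc m) n = concatMap (λ v → map (λ x → x ∷ v) (allFin n)) (allMaps m n)

allB : {X : Set} → (X → Bool) → List X → Bool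
allB p xs = foldr (λ x b → p x ∧ b) true xs

isHom : (F A : Digraph) → Vec (Vertex A) (suc (size F)) → Bool
isHom F A f =
  allB (λ p → not (edge F (proj₁ p) (proj₂ p))
             ∨ edge A (lookup f (proj₁ p)) (lookup f (proj₂ p)))
      (cartesianProduct (allFin (suc (size F))) (allFin (suc (size F))))

hom : Digraph → Digraph → ℕ
hom F A = length (filter (λ f → isHom F A f Data.Bool.≟ true) (allMaps (suc (size F)) (suc (size A))))

Class : Set₁
Class = Digraph → Set

NonAdaptiveDecides : (k : ℕ) → Vec Digraph k → (Vec ℕ k → Set) → Class → Set
NonAdaptiveDecides k Fs X C = (D : Digraph) → C D ⇔ X (Data.Vec.map (λ F → hom F D) Fs)

-- adaptive left query algorithm: a labelling of strings over ℕ
data Node : Set where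
  ask : Digraph → Node
  YES NO : Node

AdaptiveAlg : Set
AdaptiveAlg = List ℕ → Node

-- run from string σ with at most k further queries;
-- returns the final decision (true = YES) or nothing if more queries needed
run : AdaptiveAlg → Digraph → ℕ → List ℕ → Maybe Bool
run G A k σ with G σ
... | YES   = just true
... | NO    = just false
run G A zero    σ | ask F = nothing
run G A (suc k) σ | ask F = run G A k (σ ++ [ hom F A ])

AdaptiveDecides : ℕ → AdaptiveAlg → Class → Set
AdaptiveDecides k G C =
  (A : Digraph) → Σ Bool λ b → (run G A k [] ≡ just b) × (C A ⇔ (b ≡ true))

{-# OPTIONS --safe #-}
-- Adaptively, the first query hom(•, A) returns n = |V(A)|, and A has a directed cycle
-- iff it admits a walk with n edges, i.e. iff hom(Pₙ, A) > 0 for the directed path Pₙ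
-- with n edges: such a walk must repeat a vertex.
--
-- Non-adaptively, suppose all queried digraphs have fewer than N vertices.  Let C be the
-- directed N-cycle on the labels 0 … N − 1 together with the directed path N → ⋯ → 2N,
-- and P the directed path 0 → ⋯ → 2N.  A homomorphism into P labels the vertices so that
-- every edge raises the label by one.  On each weak component whose least label is below N,
-- wrapping the labels modulo N gives a homomorphism into the cycle of C; the other
-- components already lie on the path of C.  Conversely, a component mapped into the cycle
-- misses some cycle vertex (it has fewer than N vertices), so it can be cut open there and
-- unwrapped back into P with least label below N.  Wrapping is injective and undoes
-- unwrapping, hence hom(F, C) = hom(F, P) for every queried F, although C is cyclic and P
-- is not.
module Submission where

open import Defs
open import Data.Nat using (ℕ)
open import Data.Vec using (Vec)
open import Data.Product using (Σ; _×_)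
open import Relation.Nullary using (¬_)

open import Data.Bool using (Bool; true; false; not; _∨_)
open import Data.Bool.Properties using (∧-conicalˡ; ∧-conicalʳ)
open import Data.Empty using (⊥-elim)
open import Data.Fin as Fin using (Fin; zero; suc; toℕ)
import Data.Fin.Properties as Finₚ
open import Data.Fin.Relation.Unary.Top using (view; ‵fromℕ; ‵inject₁)
open import Data.List using (List; []; _∷_; _++_; length; filter; allFin; map; concatMap; cartesianProduct; cartesianProductWith)
open import Data.List.Extrema.Nat using (argmin; f[argmin]≤f[⊤]; f[argmin]≤f[xs]; argmin-sel)
open import Data.List.Membership.Propositional using (_∈_)
open import Data.List.Membership.Propositional.Properties
  using (∈-allFin; ∈-cartesianProduct⁺; ∈-cartesianProductWith⁺; ∈-filter⁺; ∈-filter⁻; ∈-∃++; ∈-++⁻; ∈-++⁺ˡ; ∈-++⁺ʳ)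
open import Data.List.Properties using (length-++; length-map; length-tabulate; filter-all)
open import Data.List.Relation.Unary.All as All using (All; []; _∷_)
open import Data.List.Relation.Unary.AllPairs using ([]; _∷_)
open import Data.List.Relation.Unary.Any using (here; there)
open import Data.List.Relation.Unary.Unique.Propositional using (Unique)
open import Data.List.Relation.Unary.Unique.Propositional.Properties
  using (cartesianProductWith⁺; allFin⁺; filter⁺; Unique[x∷xs]⇒x∉xs)
open import Data.Maybe using (just)
open import Data.Nat as ℕ using (zero; suc; _+_; _*_; _∸_; _⊔_; _≤_; _<_; z≤n; s≤s)
open import Data.Nat.DivMod
  using (_mod_; _%_; m≤n⇒m%n≡m; m<n⇒m%n≡m; m%n<n; m%n%n≡m%n; %-distribˡ-+; [m+kn]%n≡m%n; [m+n]%n≡m%n; n%n≡0)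
open import Data.Nat.Induction using (<-rec)
open import Data.Nat.ListAction using (sum)
open import Data.Nat.Properties as ℕₚ using (≤-trans; +-suc)
open import Algebra.Properties.CommutativeSemigroup ℕₚ.+-commutativeSemigroup using (x∙yz≈y∙xz; xy∙z≈xz∙y)
open import Data.Product using (∃; ∃₂; _,_; proj₁; proj₂)
open import Data.Sum using (_⊎_; inj₁; inj₂)
open import Data.Vec as Vec using ([]; _∷_; lookup; tabulate)
import Data.Vec.Properties as Vecₚ
open import Function.Bundles using (_⇔_; mk⇔; Equivalence)
open Equivalence using (to; from)
open import Function.Definitions using (Injective)
open import Function.Properties.Equivalence using (⇔-isEquivalence)
open import Relation.Binary using (DecidableEquality; tri<; tri≈; tri>)
import Relation.Binary.Construct.Closure.Equivalence as EqClosure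
open EqClosure using (EqClosure)
open import Relation.Binary.Construct.Closure.ReflexiveTransitive using (ε; _◅_)
open import Relation.Binary.Construct.Closure.Symmetric using (fwd; bwd)
open import Relation.Binary.PropositionalEquality
open import Relation.Nullary using (Dec; does; yes; no)
open import Relation.Nullary.Decidable using (_×-dec_; _⊎-dec_; decidable-stable)

length-≤-injection : ∀ {X Y : Set} {xs : List X} {ys : List Y} (φ : X → Y) → Unique xs →
  (∀ {x} → x ∈ xs → φ x ∈ ys) →
  (∀ {x y} → x ∈ xs → y ∈ xs → φ x ≡ φ y → x ≡ y) →
  length xs ≤ length ys
length-≤-injection {xs = []}     φ _            _    _   = z≤n
length-≤-injection {xs = x ∷ xs} φ (x∉ ∷ uniq) into inj with ∈-∃++ (into (here refl))
... | us , vs , refl = subst (suc (length xs) ≤_) (sym (length-++-∷ us))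
  (s≤s (length-≤-injection φ uniq into′ (λ x∈ y∈ → inj (there x∈) (there y∈))))
  where
  into′ : ∀ {y} → y ∈ xs → φ y ∈ us ++ vs
  into′ {y} y∈ with ∈-++⁻ us (into (there y∈))
  ... | inj₁ φy∈us         = ∈-++⁺ˡ φy∈us
  ... | inj₂ (there φy∈vs) = ∈-++⁺ʳ us φy∈vs
  ... | inj₂ (here φy≡φx)  =
    ⊥-elim (Unique[x∷xs]⇒x∉xs (x∉ ∷ uniq) (subst (_∈ xs) (inj (there y∈) (here refl) φy≡φx) y∈))
  length-++-∷ : ∀ us {y vs} → length (us ++ y ∷ vs) ≡ suc (length (us ++ vs))
  length-++-∷ []       = refl
  length-++-∷ (_ ∷ us) = cong suc (length-++-∷ us)

sum-map-mono-≤ : ∀ {X : Set} {g h : X → ℕ} → (∀ x → g x ≤ h x) → ∀ xs →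
  sum (map g xs) ≤ sum (map h xs)
sum-map-mono-≤ g≤h []       = z≤n
sum-map-mono-≤ g≤h (x ∷ xs) = ℕₚ.+-mono-≤ (g≤h x) (sum-map-mono-≤ g≤h xs)

sum-map-mono-< : ∀ {X : Set} {g h : X → ℕ} {u xs} → (∀ x → g x ≤ h x) → u ∈ xs → g u < h u →
  sum (map g xs) < sum (map h xs)
sum-map-mono-< {xs = _ ∷ xs} g≤h (here refl) gu<hu = ℕₚ.+-mono-<-≤ gu<hu (sum-map-mono-≤ g≤h xs)
sum-map-mono-< g≤h (there u∈) gu<hu = ℕₚ.+-mono-≤-< (g≤h _) (sum-map-mono-< g≤h u∈ gu<hu)

injective⊎collision : ∀ {n} {X : Set} → DecidableEquality X → (f : Fin n → X) →
  Injective _≡_ _≡_ f ⊎ ∃₂ λ p q → p Fin.< q × f p ≡ f q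
injective⊎collision _≟_ f with Finₚ.any? (λ p → Finₚ.any? (λ q → p Fin.<? q ×-dec f p ≟ f q))
... | yes (p , q , collision) = inj₂ (p , q , collision)
... | no ¬collision           = inj₁ injective
  where
  injective : Injective _≡_ _≡_ f
  injective {p} {q} fp≡fq with Finₚ.<-cmp p q
  ... | tri< p<q _ _ = ⊥-elim (¬collision (p , q , p<q , fp≡fq))
  ... | tri≈ _ p≡q _ = p≡q
  ... | tri> _ _ q<p = ⊥-elim (¬collision (q , p , q<p , sym fp≡fq))

missedValue : ∀ {m n} (g : Fin m → ℕ) → m < n → ∃ λ c → c < n × ∀ v → g v ≢ c
missedValue {m} {n} g m<n =
  let (c , notHit) = Finₚ.¬∀⟶∃¬ n _ (λ c → Finₚ.any? (λ v → g v ℕ.≟ toℕ c)) allHit⇒⊥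
  in toℕ c , Finₚ.toℕ<n c , λ v gv≡c → notHit (v , gv≡c)
  where
  allHit⇒⊥ : ¬ (∀ (c : Fin n) → ∃ λ v → g v ≡ toℕ c)
  allHit⇒⊥ hit = ℕₚ.<⇒≱ m<n (Finₚ.injective⇒≤ {f = λ c → proj₁ (hit c)} λ {c} {c′} eq →
    Finₚ.toℕ-injective (trans (sym (proj₂ (hit c))) (trans (cong g eq) (proj₂ (hit c′)))))

module _ {k : ℕ} where

  private
    n = suc k

  [m%n+o]%n≡[m+o]%n : ∀ m o → (m % n + o) % n ≡ (m + o) % n
  [m%n+o]%n≡[m+o]%n m o = begin
    (m % n + o) % n         ≡⟨ %-distribˡ-+ (m % n) o n ⟩
    (m % n % n + o % n) % n ≡⟨ cong (λ x → (x + o % n) % n) (m%n%n≡m%n m n) ⟩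
    (m % n + o % n) % n     ≡⟨ %-distribˡ-+ m o n ⟨
    (m + o) % n             ∎
    where open ≡-Reasoning

  [m+o%n]%n≡[m+o]%n : ∀ m o → (m + o % n) % n ≡ (m + o) % n
  [m+o%n]%n≡[m+o]%n m o = begin
    (m + o % n) % n ≡⟨ cong (_% n) (ℕₚ.+-comm m (o % n)) ⟩
    (o % n + m) % n ≡⟨ [m%n+o]%n≡[m+o]%n o m ⟩
    (o + m) % n     ≡⟨ cong (_% n) (ℕₚ.+-comm o m) ⟩
    (m + o) % n     ∎
    where open ≡-Reasoning

  [1+m]%n≡[1+m%n]%n : ∀ m → suc m % n ≡ suc (m % n) % n
  [1+m]%n≡[1+m%n]%n m = sym ([m+o%n]%n≡[m+o]%n 1 m)

  suc-% : ∀ m → m % n ≢ k → suc m % n ≡ suc (m % n)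
  suc-% m m%n≢k =
    trans ([1+m]%n≡[1+m%n]%n m) (m<n⇒m%n≡m (s≤s (ℕₚ.≤∧≢⇒< (ℕ.s≤s⁻¹ (m%n<n m n)) m%n≢k)))

  -- Adding t (n − 1) to a + t gives a + t n, which is ≡ a modulo n.
  +-%-cancelʳ : ∀ {a b} t → a < n → b < n → (a + t) % n ≡ (b + t) % n → a ≡ b
  +-%-cancelʳ {a} {b} t a<n b<n eq = begin
    a                             ≡⟨ recover a<n ⟨
    ((a + t) % n + t * k) % n     ≡⟨ cong (λ x → (x + t * k) % n) eq ⟩
    ((b + t) % n + t * k) % n     ≡⟨ recover b<n ⟩
    b                             ∎
    where
    open ≡-Reasoning
    recover : ∀ {x} → x < n → ((x + t) % n + t * k) % n ≡ x
    recover {x} x<n = begin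
      ((x + t) % n + t * k) % n ≡⟨ [m%n+o]%n≡[m+o]%n (x + t) (t * k) ⟩
      (x + t + t * k) % n       ≡⟨ cong (_% n) (ℕₚ.+-assoc x t (t * k)) ⟩
      (x + (t + t * k)) % n     ≡⟨ cong (λ y → (x + y) % n) (ℕₚ.*-suc t k) ⟨
      (x + t * n) % n           ≡⟨ [m+kn]%n≡m%n x t n ⟩
      x % n                     ≡⟨ m<n⇒m%n≡m x<n ⟩
      x                         ∎

toℕ-mod : ∀ {t m} → t ≤ m → toℕ (t mod suc m) ≡ t
toℕ-mod t≤m = trans (Finₚ.toℕ-fromℕ< _) (m≤n⇒m%n≡m t≤m)

lookupℕ : ∀ {X : Set} {m} → Vec X (suc m) → ℕ → X
lookupℕ {m = m} f t = lookup f (t mod suc m)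

lookupℕ-toℕ : ∀ {X : Set} {m} (f : Vec X (suc m)) i → lookupℕ f (toℕ i) ≡ lookup f i
lookupℕ-toℕ f i = cong (lookup f) (Finₚ.toℕ-injective (toℕ-mod (Finₚ.toℕ≤pred[n] i)))

does≡true⇔ : ∀ {P : Set} (P? : Dec P) → does P? ≡ true ⇔ P
does≡true⇔ (yes p) = mk⇔ (λ _ → p) (λ _ → refl)
does≡true⇔ (no ¬p) = mk⇔ (λ ()) (λ p → ⊥-elim (¬p p))

-- Counting homomorphisms

IsHomomorphism : (F A : Digraph) → Vec (Vertex A) (suc (size F)) → Set
IsHomomorphism F A f = ∀ i j → F ∶ i ⟶ j → A ∶ lookup f i ⟶ lookup f j

allMaps≡cartesianProductWith : ∀ m n →
  allMaps (suc m) n ≡ cartesianProductWith (λ v x → x ∷ v) (allMaps m n) (allFin n)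
allMaps≡cartesianProductWith m n = go (allMaps m n)
  where
  go : ∀ vs → concatMap (λ v → map (_∷ v) (allFin n)) vs
            ≡ cartesianProductWith (λ v x → x ∷ v) vs (allFin n)
  go []       = refl
  go (v ∷ vs) = cong (map (_∷ v) (allFin n) ++_) (go vs)

∈-allMaps : ∀ m n (v : Vec (Fin n) m) → v ∈ allMaps m n
∈-allMaps zero    n []      = here refl
∈-allMaps (suc m) n (x ∷ v) rewrite allMaps≡cartesianProductWith m n =
  ∈-cartesianProductWith⁺ (λ v x → x ∷ v) (∈-allMaps m n v) (∈-allFin x)

allMaps-unique : ∀ m n → Unique (allMaps m n)
allMaps-unique zero    n = [] ∷ []
allMaps-unique (suc m) n rewrite allMaps≡cartesianProductWith m n =
  cartesianProductWith⁺ (λ v x → x ∷ v) ∷-injective (allMaps-unique m n) (allFin⁺ n)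
  where
  ∷-injective : ∀ {v w : Vec (Fin n) m} {x y} → x ∷ v ≡ y ∷ w → v ≡ w × x ≡ y
  ∷-injective refl = refl , refl

allB≡true⇔All : ∀ {X : Set} (p : X → Bool) xs → allB p xs ≡ true ⇔ All (λ x → p x ≡ true) xs
allB≡true⇔All p xs = mk⇔ (sound xs) (complete xs)
  where
  sound : ∀ xs → allB p xs ≡ true → All (λ x → p x ≡ true) xs
  sound []       _ = []
  sound (x ∷ xs) e = ∧-conicalˡ (p x) _ e ∷ sound xs (∧-conicalʳ (p x) _ e)
  complete : ∀ xs → All (λ x → p x ≡ true) xs → allB p xs ≡ true
  complete []       []         = refl
  complete (x ∷ xs) (px ∷ pxs) rewrite px = complete xs pxs

implies⇔ : ∀ {a b} → not a ∨ b ≡ true ⇔ (a ≡ true → b ≡ true)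
implies⇔ {true}  = mk⇔ (λ b≡true _ → b≡true) (λ f → f refl)
implies⇔ {false} = mk⇔ (λ _ ()) (λ _ → refl)

isHom≡true⇔IsHomomorphism : ∀ F A f → isHom F A f ≡ true ⇔ IsHomomorphism F A f
isHom≡true⇔IsHomomorphism F A f = mk⇔
  (λ e i j → to implies⇔
     (All.lookup (to (allB≡true⇔All _ pairs) e) (∈-cartesianProduct⁺ (∈-allFin i) (∈-allFin j))))
  (λ hom → from (allB≡true⇔All _ pairs)
     (All.tabulate (λ {(i , j)} _ → from implies⇔ (hom i j))))
  where
  pairs = cartesianProduct (allFin (suc (size F))) (allFin (suc (size F)))

isHom? : ∀ F A f → Dec (isHom F A f ≡ true)
isHom? F A f = isHom F A f Data.Bool.≟ true

homomorphisms : (F A : Digraph) → List (Vec (Vertex A) (suc (size F)))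
homomorphisms F A = filter (isHom? F A) (allMaps (suc (size F)) (suc (size A)))

∈-homomorphisms⇔ : ∀ F A f → f ∈ homomorphisms F A ⇔ IsHomomorphism F A f
∈-homomorphisms⇔ F A f = mk⇔
  (λ f∈ → to (isHom≡true⇔IsHomomorphism F A f) (proj₂ (∈-filter⁻ (isHom? F A) {xs = allMaps _ _} f∈)))
  (λ hom → ∈-filter⁺ (isHom? F A) (∈-allMaps _ _ f) (from (isHom≡true⇔IsHomomorphism F A f) hom))

homomorphisms-unique : ∀ F A → Unique (homomorphisms F A)
homomorphisms-unique F A = filter⁺ (isHom? F A) (allMaps-unique (suc (size F)) (suc (size A)))

hom-≤-injection : ∀ F A B (φ : Vec (Vertex A) (suc (size F)) → Vec (Vertex B) (suc (size F))) →
  (∀ f → IsHomomorphism F A f → IsHomomorphism F B (φ f)) →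
  (∀ {f g} → IsHomomorphism F A f → IsHomomorphism F A g → φ f ≡ φ g → f ≡ g) →
  hom F A ≤ hom F B
hom-≤-injection F A B φ preserves injective =
  length-≤-injection φ (homomorphisms-unique F A)
    (λ f∈ → from (∈-homomorphisms⇔ F B _) (preserves _ (to (∈-homomorphisms⇔ F A _) f∈)))
    (λ f∈ g∈ → injective (to (∈-homomorphisms⇔ F A _) f∈) (to (∈-homomorphisms⇔ F A _) g∈))

0<hom⇔IsHomomorphism : ∀ F A → 0 < hom F A ⇔ ∃ (IsHomomorphism F A)
0<hom⇔IsHomomorphism F A = mk⇔ (witness (homomorphisms F A) (λ f∈ → to (∈-homomorphisms⇔ F A _) f∈))
  (λ (f , hom) → nonempty (from (∈-homomorphisms⇔ F A f) hom))
  where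
  witness : ∀ fs → (∀ {f} → f ∈ fs → IsHomomorphism F A f) → 0 < length fs → ∃ (IsHomomorphism F A)
  witness (f ∷ _) homs _ = f , homs (here refl)
  nonempty : ∀ {f} {fs : List (Vec (Vertex A) (suc (size F)))} → f ∈ fs → 0 < length fs
  nonempty {fs = _ ∷ _} _ = s≤s z≤n

Point : Digraph
Point = digraph 0 (λ _ _ → false)

hom-Point : ∀ A → hom Point A ≡ suc (size A)
hom-Point A = begin
  hom Point A                           ≡⟨ cong length (filter-all (isHom? Point A) everyMapIsHom) ⟩
  length (map (_∷ []) (allFin n) ++ []) ≡⟨ length-++ (map (_∷ []) (allFin n)) ⟩
  length (map (_∷ []) (allFin n)) + 0   ≡⟨ ℕₚ.+-identityʳ _ ⟩
  length (map (_∷ []) (allFin n))       ≡⟨ length-map _ (allFin n) ⟩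
  length (allFin n)                     ≡⟨ length-tabulate (λ i → i) ⟩
  n                                     ∎
  where
  open ≡-Reasoning
  n = suc (size A)
  everyMapIsHom : All (λ f → isHom Point A f ≡ true) (allMaps 1 n)
  everyMapIsHom = All.universal (λ _ → refl) (allMaps 1 n)

-- Functional digraphs and labellings

Functional : ℕ → (ℕ → ℕ) → Digraph
Functional m σ = digraph m (λ i j → does (toℕ j ℕ.≟ σ (toℕ i)))

Path : ℕ → Digraph
Path m = Functional m suc

Functional-edge⇔ : ∀ {m σ} {i j : Fin (suc m)} → Functional m σ ∶ i ⟶ j ⇔ toℕ j ≡ σ (toℕ i)
Functional-edge⇔ {m} {σ} {i} {j} = does≡true⇔ (toℕ j ℕ.≟ σ (toℕ i))

Respects : (F : Digraph) → (ℕ → ℕ) → (Vertex F → ℕ) → Set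
Respects F σ h = ∀ i j → F ∶ i ⟶ j → h j ≡ σ (h i)

IsLabelling : (F : Digraph) → ℕ → (ℕ → ℕ) → (Vertex F → ℕ) → Set
IsLabelling F m σ h = (∀ v → h v ≤ m) × Respects F σ h

module _ {n m : ℕ} where

  labels : Vec (Fin (suc m)) n → Fin n → ℕ
  labels f v = toℕ (lookup f v)

  fromLabels : (Fin n → ℕ) → Vec (Fin (suc m)) n
  fromLabels h = tabulate (λ v → h v mod suc m)

  labels-fromLabels : ∀ {h} → (∀ v → h v ≤ m) → ∀ v → labels (fromLabels h) v ≡ h v
  labels-fromLabels {h} h≤m v =
    trans (cong toℕ (Vecₚ.lookup∘tabulate (λ v → h v mod suc m) v)) (toℕ-mod (h≤m v))

  labels-injective : ∀ {f g} → (∀ v → labels f v ≡ labels g v) → f ≡ g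
  labels-injective {f} {g} f≗g = begin
    f                   ≡⟨ Vecₚ.tabulate∘lookup f ⟨
    tabulate (lookup f) ≡⟨ Vecₚ.tabulate-cong (λ v → Finₚ.toℕ-injective (f≗g v)) ⟩
    tabulate (lookup g) ≡⟨ Vecₚ.tabulate∘lookup g ⟩
    g                   ∎
    where open ≡-Reasoning

module _ {F : Digraph} {m : ℕ} {σ : ℕ → ℕ} where

  IsHomomorphism⇒IsLabelling : ∀ {f} → IsHomomorphism F (Functional m σ) f →
    IsLabelling F m σ (labels f)
  IsHomomorphism⇒IsLabelling {f} hom =
    (λ v → Finₚ.toℕ≤pred[n] (lookup f v)) , (λ i j e → to (Functional-edge⇔ {σ = σ}) (hom i j e))

  IsLabelling⇒IsHomomorphism : ∀ {h} → IsLabelling F m σ h →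
    IsHomomorphism F (Functional m σ) (fromLabels h)
  IsLabelling⇒IsHomomorphism {h} (h≤m , resp) i j e = from (Functional-edge⇔ {σ = σ}) (begin
    labels (fromLabels h) j     ≡⟨ labels-fromLabels h≤m j ⟩
    h j                         ≡⟨ resp i j e ⟩
    σ (h i)                     ≡⟨ cong σ (labels-fromLabels h≤m i) ⟨
    σ (labels (fromLabels h) i) ∎)
    where open ≡-Reasoning

hom-Functional-≤ : ∀ F {m σ m′ σ′} (Θ : (Vertex F → ℕ) → Vertex F → ℕ) →
  (∀ {h} → IsLabelling F m σ h → IsLabelling F m′ σ′ (Θ h)) →
  (∀ {h h′} → IsLabelling F m σ h → IsLabelling F m σ h′ →
     (∀ v → Θ h v ≡ Θ h′ v) → ∀ v → h v ≡ h′ v) →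
  hom F (Functional m σ) ≤ hom F (Functional m′ σ′)
hom-Functional-≤ F {m} {σ} {m′} {σ′} Θ preserves injective =
  hom-≤-injection F (Functional m σ) (Functional m′ σ′) φ
    (λ f hom → IsLabelling⇒IsHomomorphism {σ = σ′} (preserves (lab f hom)))
    (λ {f} {g} homf homg φf≡φg → labels-injective (injective (lab f homf) (lab g homg) (λ v → begin
      Θ (labels f) v    ≡⟨ labels-fromLabels (proj₁ (preserves (lab f homf))) v ⟨
      labels (φ f) v    ≡⟨ cong (λ x → labels x v) φf≡φg ⟩
      labels (φ g) v    ≡⟨ labels-fromLabels (proj₁ (preserves (lab g homg))) v ⟩
      Θ (labels g) v    ∎)))
  where
  open ≡-Reasoning
  φ : Vec (Fin (suc m)) (suc (size F)) → Vec (Fin (suc m′)) (suc (size F))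
  φ f = fromLabels (Θ (labels f))
  lab : ∀ f → IsHomomorphism F (Functional m σ) f → IsLabelling F m σ (labels f)
  lab f = IsHomomorphism⇒IsLabelling {σ = σ} {f = f}

-- Walks, cycles and the adaptive algorithm

module _ (A : Digraph) where

  IsWalk : ℕ → (ℕ → Vertex A) → Set
  IsWalk L a = ∀ t → t < L → A ∶ a t ⟶ a (suc t)

  IsClosedWalk : ℕ → (ℕ → Vertex A) → Set
  IsClosedWalk L a = IsWalk L a × a L ≡ a 0

  closedSubwalk : ∀ {L a p q} → IsWalk L a → p < q → q ≤ L → a p ≡ a q →
    IsClosedWalk (q ∸ p) (λ t → a (p + t))
  closedSubwalk {L} {a} {p} {q} walk p<q q≤L ap≡aq = subwalk , closed
    where
    p+[q∸p]≡q : p + (q ∸ p) ≡ q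
    p+[q∸p]≡q = ℕₚ.m+[n∸m]≡n (ℕₚ.<⇒≤ p<q)
    subwalk : IsWalk (q ∸ p) (λ t → a (p + t))
    subwalk t t<q∸p = subst (λ s → A ∶ a (p + t) ⟶ a s) (sym (+-suc p t))
      (walk (p + t) (ℕₚ.<-≤-trans (subst (p + t <_) p+[q∸p]≡q (ℕₚ.+-monoʳ-< p t<q∸p)) q≤L))
    closed : a (p + (q ∸ p)) ≡ a (p + 0)
    closed = trans (cong a p+[q∸p]≡q) (trans (sym ap≡aq) (cong a (sym (ℕₚ.+-identityʳ p))))

  closedWalk⇒cycle : ∀ L {a} → 0 < L → IsClosedWalk L a → HasDirectedCycle A
  closedWalk⇒cycle = <-rec _ go
    where
    go : ∀ L → (∀ {L′} → L′ < L → ∀ {a} → 0 < L′ → IsClosedWalk L′ a → HasDirectedCycle A) →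
         ∀ {a} → 0 < L → IsClosedWalk L a → HasDirectedCycle A
    go (suc ℓ) shorter {a} _ (walk , closed)
      with injective⊎collision Finₚ._≟_ (λ (i : Fin (suc ℓ)) → a (toℕ i))
    ... | inj₁ injective = ℓ , (λ i → a (toℕ i)) , injective , edges , closing
      where
      edges : (i : Fin ℓ) → A ∶ a (toℕ (Fin.inject₁ i)) ⟶ a (suc (toℕ i))
      edges i rewrite Finₚ.toℕ-inject₁ i = walk (toℕ i) (ℕₚ.m<n⇒m<1+n (Finₚ.toℕ<n i))
      closing : A ∶ a (toℕ (Fin.fromℕ ℓ)) ⟶ a 0
      closing rewrite Finₚ.toℕ-fromℕ ℓ = subst (A ∶ a ℓ ⟶_) closed (walk ℓ (ℕₚ.n<1+n ℓ))
    ... | inj₂ (p , q , p<q , ap≡aq) =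
      shorter (ℕₚ.≤-<-trans (ℕₚ.m∸n≤m (toℕ q) (toℕ p)) (Finₚ.toℕ<n q)) (ℕₚ.m<n⇒0<n∸m p<q)
        (closedSubwalk walk p<q (ℕₚ.<⇒≤ (Finₚ.toℕ<n q)) ap≡aq)

  homPath⇒walk : ∀ {m f} → IsHomomorphism (Path m) A f → IsWalk m (lookupℕ f)
  homPath⇒walk {m} hom t t<m = hom (t mod suc m) (suc t mod suc m)
    (from (Functional-edge⇔ {σ = suc}) (trans (toℕ-mod t<m) (cong suc (sym (toℕ-mod (ℕₚ.<⇒≤ t<m))))))

  walk⇒homPath : ∀ {m a} → IsWalk m a → IsHomomorphism (Path m) A (tabulate (λ i → a (toℕ i)))
  walk⇒homPath {m} {a} walk i j i⟶j =
    subst₂ (A ∶_⟶_) (sym (Vecₚ.lookup∘tabulate (λ i → a (toℕ i)) i))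
                    (sym (Vecₚ.lookup∘tabulate (λ i → a (toℕ i)) j))
      (subst (λ s → A ∶ a (toℕ i) ⟶ a s) (sym j≡1+i) (walk (toℕ i) i<m))
    where
    j≡1+i : toℕ j ≡ suc (toℕ i)
    j≡1+i = to (Functional-edge⇔ {σ = suc}) i⟶j
    i<m : toℕ i < m
    i<m = ℕ.s<s⁻¹ (subst (_< suc m) j≡1+i (Finₚ.toℕ<n j))

  cycle⇒infiniteWalk : HasDirectedCycle A → ∃ λ a → ∀ t → A ∶ a t ⟶ a (suc t)
  cycle⇒infiniteWalk (ℓ , c , _ , edges , closing) =
    (λ t → c (position t)) , (λ t → proj₂ (successor (position t)))
    where
    successor : ∀ i → ∃ λ j → A ∶ c i ⟶ c j
    successor i with view i
    ... | ‵fromℕ     = zero , closing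
    ... | ‵inject₁ j = suc j , edges j
    position : ℕ → Fin (suc ℓ)
    position zero    = zero
    position (suc t) = proj₁ (successor (position t))

  0<homPath⇔cycle : ∀ {m} → size A < m → 0 < hom (Path m) A ⇔ HasDirectedCycle A
  0<homPath⇔cycle {m} |A|≤m = mk⇔
    (λ 0<hom → homPath⇒cycle (to (0<hom⇔IsHomomorphism (Path m) A) 0<hom))
    (λ cycle → let (a , walk) = cycle⇒infiniteWalk cycle in
      from (0<hom⇔IsHomomorphism (Path m) A) (tabulate (λ i → a (toℕ i)) , walk⇒homPath (λ t _ → walk t)))
    where
    homPath⇒cycle : ∃ (IsHomomorphism (Path m) A) → HasDirectedCycle A
    homPath⇒cycle (f , hom) with Finₚ.pigeonhole (s≤s |A|≤m) (lookup f)
    ... | p , q , p<q , fp≡fq = closedWalk⇒cycle (toℕ q ∸ toℕ p) (ℕₚ.m<n⇒0<n∸m p<q)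
      (closedSubwalk (homPath⇒walk {f = f} hom) p<q (Finₚ.toℕ≤pred[n] q)
        (trans (lookupℕ-toℕ f p) (trans fp≡fq (sym (lookupℕ-toℕ f q)))))

Path-acyclic : ∀ m → ¬ HasDirectedCycle (Path m)
Path-acyclic m cycle with cycle⇒infiniteWalk (Path m) cycle
... | a , walk = ℕₚ.<-irrefl refl (ℕₚ.<-≤-trans (height (suc m)) (Finₚ.toℕ≤pred[n] (a (suc m))))
  where
  height : ∀ t → t ≤ toℕ (a t)
  height zero    = z≤n
  height (suc t) = subst (suc t ≤_) (sym (to (Functional-edge⇔ {σ = suc}) (walk t))) (s≤s (height t))

cycleDetector : AdaptiveAlg
cycleDetector []                = ask Point
cycleDetector (n ∷ [])          = ask (Path n)
cycleDetector (_ ∷ zero ∷ [])   = NO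
cycleDetector (_ ∷ suc _ ∷ [])  = YES
cycleDetector (_ ∷ _ ∷ _ ∷ _)   = YES   -- never reached: a run stops after two answers

cycleDetector-decides : AdaptiveDecides 2 cycleDetector HasDirectedCycle
cycleDetector-decides A = decide (hom (Path n) A) refl
  -- run cycleDetector A 2 [] unfolds to run cycleDetector A 0 (n ∷ hom (Path n) A ∷ []).
  where
  n = hom Point A
  0<hom⇔cycle : 0 < hom (Path n) A ⇔ HasDirectedCycle A
  0<hom⇔cycle = 0<homPath⇔cycle A (subst (size A <_) (sym (hom-Point A)) (ℕₚ.n<1+n (size A)))
  decide : ∀ k → hom (Path n) A ≡ k →
    Σ Bool λ b → (run cycleDetector A 0 (n ∷ k ∷ []) ≡ just b) × (HasDirectedCycle A ⇔ (b ≡ true))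
  decide zero    hom≡0 = false , refl ,
    mk⇔ (λ cycle → ⊥-elim (ℕₚ.<⇒≢ (from 0<hom⇔cycle cycle) (sym hom≡0))) (λ ())
  decide (suc k) hom≡1+k = true , refl ,
    mk⇔ (λ _ → refl) (λ _ → to 0<hom⇔cycle (subst (0 <_) (sym hom≡1+k) (s≤s z≤n)))

-- Weak components and their minima

module Components (F : Digraph) where

  _~_ : Vertex F → Vertex F → Set
  _~_ = EqClosure (F ∶_⟶_)

  ~-refl : ∀ {v} → v ~ v
  ~-refl = EqClosure.reflexive _

  ~-sym : ∀ {u v} → u ~ v → v ~ u
  ~-sym = EqClosure.symmetric _

  ~-trans : ∀ {u v w} → u ~ v → v ~ w → u ~ w
  ~-trans = EqClosure.transitive _

  ⟶⇒~ : ∀ {u v} → F ∶ u ⟶ v → u ~ v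
  ⟶⇒~ = EqClosure.return

  Adjacent : Vertex F → Vertex F → Set
  Adjacent u v = F ∶ u ⟶ v ⊎ F ∶ v ⟶ u

  adjacent? : ∀ u v → Dec (Adjacent u v)
  adjacent? u v = (edge F u v Data.Bool.≟ true) ⊎-dec (edge F v u Data.Bool.≟ true)

  Adjacent⇒~ : ∀ {u v} → Adjacent u v → u ~ v
  Adjacent⇒~ (inj₁ u⟶v) = ⟶⇒~ u⟶v
  Adjacent⇒~ (inj₂ v⟶u) = ~-sym (⟶⇒~ v⟶u)

  neighbours : Vertex F → List (Vertex F)
  neighbours v = filter (λ u → adjacent? u v) (allFin _)

  relax : (Vertex F → ℕ) → Vertex F → ℕ
  relax h v = h (argmin h v (neighbours v))

  relax-≤ : ∀ h v → relax h v ≤ h v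
  relax-≤ h v = f[argmin]≤f[⊤] {f = h} v (neighbours v)

  relax-≤-adjacent : ∀ h {u v} → Adjacent u v → relax h v ≤ h u
  relax-≤-adjacent h {u} {v} adj =
    All.lookup (f[argmin]≤f[xs] {f = h} v (neighbours v)) (∈-filter⁺ (λ u → adjacent? u v) (∈-allFin u) adj)

  relax-attained : ∀ h v → ∃ λ w → w ~ v × relax h v ≡ h w
  relax-attained h v with argmin-sel h v (neighbours v)
  ... | inj₁ argmin≡v = _ , subst (_~ v) (sym argmin≡v) ~-refl , refl
  ... | inj₂ argmin∈  = _ , Adjacent⇒~ (proj₂ (∈-filter⁻ (λ u → adjacent? u v) {xs = allFin _} argmin∈)) , refl

  Stable : (Vertex F → ℕ) → Set
  Stable g = ∀ v → relax g v ≡ g v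

  Stable⇒constant : ∀ {g} → Stable g → ∀ {u v} → u ~ v → g u ≡ g v
  Stable⇒constant {g} stable = EqClosure.gfold isEquivalence g λ {u} {v} u⟶v → ℕₚ.≤-antisym
    (subst (_≤ g v) (stable u) (relax-≤-adjacent g (inj₂ u⟶v)))
    (subst (_≤ g u) (stable v) (relax-≤-adjacent g (inj₁ u⟶v)))

  total : (Vertex F → ℕ) → ℕ
  total h = sum (map h (allFin _))

  relaxUntilStable : ℕ → (Vertex F → ℕ) → Vertex F → ℕ
  relaxUntilStable zero    h = h
  relaxUntilStable (suc k) h with Finₚ.all? (λ v → relax h v ℕ.≟ h v)
  ... | yes _ = h
  ... | no _  = relaxUntilStable k (relax h)

  relaxUntilStable-stable : ∀ k h → total h < k → Stable (relaxUntilStable k h)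
  relaxUntilStable-stable (suc k) h total<k with Finₚ.all? (λ v → relax h v ℕ.≟ h v)
  ... | yes stable = stable
  ... | no ¬stable = relaxUntilStable-stable k (relax h) (ℕₚ.<-≤-trans decrease (ℕ.s≤s⁻¹ total<k))
    where
    decrease : total (relax h) < total h
    decrease with Finₚ.¬∀⟶∃¬ _ _ (λ v → relax h v ℕ.≟ h v) ¬stable
    ... | v , changed = sum-map-mono-< (relax-≤ h) (∈-allFin v) (ℕₚ.≤∧≢⇒< (relax-≤ h v) changed)

  ComponentMinorant : (Vertex F → ℕ) → (Vertex F → ℕ) → Set
  ComponentMinorant h g = (∀ v → g v ≤ h v) × (∀ v → ∃ λ w → w ~ v × g v ≡ h w)

  ComponentMinorant-refl : ∀ h → ComponentMinorant h h
  ComponentMinorant-refl h = (λ _ → ℕₚ.≤-refl) , λ v → v , ~-refl , refl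

  relaxUntilStable-minorant : ∀ k {h g} → ComponentMinorant h g → ComponentMinorant h (relaxUntilStable k g)
  relaxUntilStable-minorant zero    minorant = minorant
  relaxUntilStable-minorant (suc k) {h} {g} (g≤h , attained) with Finₚ.all? (λ v → relax g v ℕ.≟ g v)
  ... | yes _ = g≤h , attained
  ... | no _  = relaxUntilStable-minorant k ((λ v → ≤-trans (relax-≤ g v) (g≤h v)) , attained′)
    where
    attained′ : ∀ v → ∃ λ w → w ~ v × relax g v ≡ h w
    attained′ v with relax-attained g v
    ... | w , w~v , eq with attained w
    ...   | w′ , w′~w , eq′ = w′ , ~-trans w′~w w~v , trans eq eq′

  -- Each unstable round strictly decreases total, so suc (total h) rounds reach a stable function.
  -- Opaque, since otherwise a case split on componentMin h v unfolds the whole loop.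
  opaque
    componentMin : (Vertex F → ℕ) → Vertex F → ℕ
    componentMin h = relaxUntilStable (suc (total h)) h

    componentMin-≤ : ∀ h {x v} → x ~ v → componentMin h v ≤ h x
    componentMin-≤ h {x} x~v =
      subst (_≤ h x) (Stable⇒constant (relaxUntilStable-stable (suc (total h)) h ℕₚ.≤-refl) x~v)
        (proj₁ (relaxUntilStable-minorant (suc (total h)) (ComponentMinorant-refl h)) x)

    componentMin-attained : ∀ h v → ∃ λ w → w ~ v × componentMin h v ≡ h w
    componentMin-attained h = proj₂ (relaxUntilStable-minorant (suc (total h)) (ComponentMinorant-refl h))

  componentMin-≤-self : ∀ h {v} → componentMin h v ≤ h v
  componentMin-≤-self h = componentMin-≤ h ~-refl

  componentMin-cong : ∀ h {u v} → u ~ v → componentMin h u ≡ componentMin h v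
  componentMin-cong h u~v = ℕₚ.≤-antisym (≤-along u~v) (≤-along (~-sym u~v))
    where
    ≤-along : ∀ {u v} → u ~ v → componentMin h u ≤ componentMin h v
    ≤-along {u} {v} u~v with componentMin-attained h v
    ... | w , w~v , eq = subst (componentMin h u ≤_) (sym eq) (componentMin-≤ h (~-trans w~v (~-sym u~v)))

  componentMin-shift-≤ : ∀ h h′ {v a b} → (∀ {x} → x ~ v → h′ x + a ≤ h x + b) →
    componentMin h′ v + a ≤ componentMin h v + b
  componentMin-shift-≤ h h′ {v} {a} {b} h′+a≤h+b with componentMin-attained h v
  ... | w , w~v , eq = begin
    componentMin h′ v + a ≤⟨ ℕₚ.+-monoˡ-≤ a (componentMin-≤ h′ w~v) ⟩
    h′ w + a              ≤⟨ h′+a≤h+b w~v ⟩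
    h w + b               ≡⟨ cong (_+ b) eq ⟨
    componentMin h v + b  ∎
    where open ℕₚ.≤-Reasoning

  componentMin-shift : ∀ h h′ {v a b} → (∀ {x} → x ~ v → h′ x + a ≡ h x + b) →
    componentMin h′ v + a ≡ componentMin h v + b
  componentMin-shift h h′ h′+a≡h+b = ℕₚ.≤-antisym
    (componentMin-shift-≤ h h′ (λ x~v → ℕₚ.≤-reflexive (h′+a≡h+b x~v)))
    (componentMin-shift-≤ h′ h (λ x~v → ℕₚ.≤-reflexive (sym (h′+a≡h+b x~v))))

  componentMin-resp-≗ : ∀ {h h′} → (∀ x → h x ≡ h′ x) → ∀ v → componentMin h v ≡ componentMin h′ v
  componentMin-resp-≗ {h} {h′} h≗h′ v =
    ℕₚ.+-cancelʳ-≡ 0 _ _ (componentMin-shift h′ h (λ {x} _ → cong (_+ 0) (h≗h′ x)))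

  invariant-constant : ∀ {σ g} (P : ℕ → Set) → (∀ x → P x ⇔ P (σ x)) → Respects F σ g →
    ∀ {u v} → u ~ v → P (g u) ⇔ P (g v)
  invariant-constant {σ} {g} P P⇔Pσ resp = EqClosure.gfold ⇔-isEquivalence (λ x → P (g x))
    λ {u} {v} u⟶v → subst (λ y → P (g u) ⇔ P y) (sym (resp u v u⟶v)) (P⇔Pσ (g u))

  levelling-difference : ∀ {h h′} → Respects F suc h → Respects F suc h′ →
    ∀ {x v} → x ~ v → h′ x + h v ≡ h x + h′ v
  levelling-difference {h} {h′} _ _ {x} ε = ℕₚ.+-comm (h′ x) (h x)
  levelling-difference {h} {h′} r r′ {x} {v} (_◅_ {j = y} (fwd x⟶y) y~v) = ℕₚ.suc-injective (begin
    suc (h′ x) + h v ≡⟨ cong (_+ h v) (r′ x y x⟶y) ⟨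
    h′ y + h v       ≡⟨ levelling-difference r r′ y~v ⟩
    h y + h′ v       ≡⟨ cong (_+ h′ v) (r x y x⟶y) ⟩
    suc (h x) + h′ v ∎)
    where open ≡-Reasoning
  levelling-difference {h} {h′} r r′ {x} {v} (_◅_ {j = y} (bwd y⟶x) y~v) = begin
    h′ x + h v       ≡⟨ cong (_+ h v) (r′ y x y⟶x) ⟩
    suc (h′ y) + h v ≡⟨ cong suc (levelling-difference r r′ y~v) ⟩
    suc (h y) + h′ v ≡⟨ cong (_+ h′ v) (r y x y⟶x) ⟨
    h x + h′ v       ∎
    where open ≡-Reasoning

-- Two digraphs that no small digraph distinguishes

maxSize : ∀ {k} → Vec Digraph k → ℕ
maxSize []       = 0
maxSize (F ∷ Fs) = size F ⊔ maxSize Fs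

module Construction (K : ℕ) where

  N M : ℕ
  N = suc K
  M = N + N

  N≤M : N ≤ M
  N≤M = ℕₚ.m≤m+n N N

  step : ℕ → ℕ
  step x with x ℕ.<? N
  ... | yes _ = suc x % N
  ... | no _  = suc x

  step-< : ∀ {x} → x < N → step x ≡ suc x % N
  step-< {x} x<N with x ℕ.<? N
  ... | yes _   = refl
  ... | no x≮N = ⊥-elim (x≮N x<N)

  step-≮ : ∀ {x} → ¬ x < N → step x ≡ suc x
  step-≮ {x} x≮N with x ℕ.<? N
  ... | yes x<N = ⊥-elim (x≮N x<N)
  ... | no _    = refl

  <N⇔step<N : ∀ x → x < N ⇔ step x < N
  <N⇔step<N x = mk⇔ (λ x<N → subst (_< N) (sym (step-< x<N)) (m%n<n (suc x) N)) step<N⇒<N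
    where
    step<N⇒<N : step x < N → x < N
    step<N⇒<N stepx<N = decidable-stable (x ℕ.<? N)
      (λ x≮N → x≮N (ℕₚ.<-trans (ℕₚ.n<1+n x) (subst (_< N) (step-≮ x≮N) stepx<N)))

  CyclePlusPath : Digraph
  CyclePlusPath = Functional M step

  CyclePlusPath-cyclic : HasDirectedCycle CyclePlusPath
  CyclePlusPath-cyclic = closedWalk⇒cycle CyclePlusPath N {a} (s≤s z≤n) (walk , closed)
    where
    a : ℕ → Vertex CyclePlusPath
    a t = (t % N) mod suc M
    toℕ-a : ∀ t → toℕ (a t) ≡ t % N
    toℕ-a t = toℕ-mod (ℕₚ.≤-trans (ℕₚ.<⇒≤ (m%n<n t N)) N≤M)
    walk : IsWalk CyclePlusPath N a
    walk t _ = from (Functional-edge⇔ {σ = step} {i = a t} {j = a (suc t)}) (begin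
      toℕ (a (suc t))         ≡⟨ toℕ-a (suc t) ⟩
      suc t % N               ≡⟨ [1+m]%n≡[1+m%n]%n {K} t ⟩
      suc (t % N) % N         ≡⟨ step-< (m%n<n t N) ⟨
      step (t % N)            ≡⟨ cong step (toℕ-a t) ⟨
      step (toℕ (a t))        ∎)
      where open ≡-Reasoning
    closed : a N ≡ a 0
    closed = cong (_mod suc M) (n%n≡0 N)

  module _ (F : Digraph) where
    open Components F

    wrap : (Vertex F → ℕ) → Vertex F → ℕ
    wrap h v with componentMin h v ℕ.<? N
    ... | yes _ = h v % N
    ... | no _  = h v

    wrap-< : ∀ {h v} → componentMin h v < N → wrap h v ≡ h v % N
    wrap-< {h} {v} μ<N with componentMin h v ℕ.<? N
    ... | yes _  = refl
    ... | no μ≮N = ⊥-elim (μ≮N μ<N)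

    wrap-≮ : ∀ {h v} → ¬ componentMin h v < N → wrap h v ≡ h v
    wrap-≮ {h} {v} μ≮N with componentMin h v ℕ.<? N
    ... | yes μ<N = ⊥-elim (μ≮N μ<N)
    ... | no _    = refl

    wrap-cong : ∀ {h h′} → (∀ x → h x ≡ h′ x) → ∀ v → wrap h v ≡ wrap h′ v
    wrap-cong {h} {h′} h≗h′ v = go (componentMin h v ℕ.<? N)
      where
      μ≡μ′ : componentMin h v ≡ componentMin h′ v
      μ≡μ′ = componentMin-resp-≗ h≗h′ v
      go : Dec (componentMin h v < N) → wrap h v ≡ wrap h′ v
      go (yes μ<N) = trans (wrap-< μ<N)
        (trans (cong (_% N) (h≗h′ v)) (sym (wrap-< (subst (_< N) μ≡μ′ μ<N))))
      go (no μ≮N)  = trans (wrap-≮ μ≮N)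
        (trans (h≗h′ v) (sym (wrap-≮ (λ μ′<N → μ≮N (subst (_< N) (sym μ≡μ′) μ′<N)))))

    wrap-preserves : ∀ {h} → IsLabelling F M suc h → IsLabelling F M step (wrap h)
    wrap-preserves {h} (h≤M , resp) = bounded , resp′
      where
      bounded : ∀ v → wrap h v ≤ M
      bounded v = go (componentMin h v ℕ.<? N)
        where
        go : Dec (componentMin h v < N) → wrap h v ≤ M
        go (yes μ<N) = subst (_≤ M) (sym (wrap-< μ<N)) (ℕₚ.≤-trans (ℕₚ.<⇒≤ (m%n<n (h v) N)) N≤M)
        go (no μ≮N)  = subst (_≤ M) (sym (wrap-≮ μ≮N)) (h≤M v)
      resp′ : Respects F step (wrap h)
      resp′ i j i⟶j = go (componentMin h i ℕ.<? N)
        where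
        open ≡-Reasoning
        μi≡μj : componentMin h i ≡ componentMin h j
        μi≡μj = componentMin-cong h (⟶⇒~ i⟶j)
        go : Dec (componentMin h i < N) → wrap h j ≡ step (wrap h i)
        go (yes μ<N) = begin
          wrap h j          ≡⟨ wrap-< (subst (_< N) μi≡μj μ<N) ⟩
          h j % N           ≡⟨ cong (_% N) (resp i j i⟶j) ⟩
          suc (h i) % N     ≡⟨ [1+m]%n≡[1+m%n]%n {K} (h i) ⟩
          suc (h i % N) % N ≡⟨ step-< (m%n<n (h i) N) ⟨
          step (h i % N)    ≡⟨ cong step (wrap-< μ<N) ⟨
          step (wrap h i)   ∎
        go (no μ≮N) = begin
          wrap h j        ≡⟨ wrap-≮ (λ μ<N → μ≮N (subst (_< N) (sym μi≡μj) μ<N)) ⟩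
          h j             ≡⟨ resp i j i⟶j ⟩
          suc (h i)       ≡⟨ step-≮ (λ hi<N → μ≮N (ℕₚ.≤-<-trans (componentMin-≤-self h) hi<N)) ⟨
          step (h i)      ≡⟨ cong step (wrap-≮ μ≮N) ⟨
          step (wrap h i) ∎

    levellings-≡-mod : ∀ {h h′ v} → Respects F suc h → Respects F suc h′ →
      componentMin h v < N → componentMin h′ v < N → h v % N ≡ h′ v % N → h v ≡ h′ v
    levellings-≡-mod {h} {h′} {v} resp resp′ μ<N μ′<N hv≡h′v = begin
      h v       ≡⟨ hv ⟩
      μ + t     ≡⟨ cong (_+ t) μ≡μ′ ⟩
      μ′ + t    ≡⟨ h′v ⟨
      h′ v      ∎
      where
      open ≡-Reasoning
      μ = componentMin h v
      μ′ = componentMin h′ v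
      t = h v ∸ μ
      hv : h v ≡ μ + t
      hv = sym (ℕₚ.m+[n∸m]≡n (componentMin-≤-self h))
      shift : μ′ + h v ≡ μ + h′ v
      shift = componentMin-shift h h′ (levelling-difference resp resp′)
      h′v : h′ v ≡ μ′ + t
      h′v = ℕₚ.+-cancelˡ-≡ μ _ _ (begin
        μ + h′ v      ≡⟨ shift ⟨
        μ′ + h v      ≡⟨ cong (μ′ +_) hv ⟩
        μ′ + (μ + t)  ≡⟨ x∙yz≈y∙xz μ′ μ t ⟩
        μ + (μ′ + t)  ∎)
      μ≡μ′ : μ ≡ μ′
      μ≡μ′ = +-%-cancelʳ t μ<N μ′<N (trans (cong (_% N) (sym hv)) (trans hv≡h′v (cong (_% N) h′v)))

    wrap-injective : ∀ {h h′} → IsLabelling F M suc h → IsLabelling F M suc h′ →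
      (∀ v → wrap h v ≡ wrap h′ v) → ∀ v → h v ≡ h′ v
    wrap-injective {h} {h′} (_ , resp) (_ , resp′) wrap≗ v =
      go (componentMin h v ℕ.<? N) (componentMin h′ v ℕ.<? N)
      where
      go : Dec (componentMin h v < N) → Dec (componentMin h′ v < N) → h v ≡ h′ v
      go (yes μ<N) (yes μ′<N) =
        levellings-≡-mod resp resp′ μ<N μ′<N (trans (sym (wrap-< μ<N)) (trans (wrap≗ v) (wrap-< μ′<N)))
      go (yes μ<N) (no μ′≮N) = ⊥-elim (μ′≮N (ℕₚ.≤-<-trans (componentMin-≤-self h′)
        (subst (_< N) (trans (sym (wrap-< μ<N)) (trans (wrap≗ v) (wrap-≮ μ′≮N))) (m%n<n (h v) N))))
      go (no μ≮N) (yes μ′<N) = ⊥-elim (μ≮N (ℕₚ.≤-<-trans (componentMin-≤-self h)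
        (subst (_< N) (trans (sym (wrap-< μ′<N)) (trans (sym (wrap≗ v)) (wrap-≮ μ≮N))) (m%n<n (h′ v) N))))
      go (no μ≮N) (no μ′≮N) = trans (sym (wrap-≮ μ≮N)) (trans (wrap≗ v) (wrap-≮ μ′≮N))

    module Unwrap (small : suc (size F) < N) (g : Vertex F → ℕ) where

      gap : ℕ
      gap = proj₁ (missedValue g small)

      gap<N : gap < N
      gap<N = proj₁ (proj₂ (missedValue g small))

      g≢gap : ∀ v → g v ≢ gap
      g≢gap = proj₂ (proj₂ (missedValue g small))

      -- Cut the cycle open after the gap: gap + 1 gets label 0 and gap gets label K.
      rotate : Vertex F → ℕ
      rotate v = (g v + (K ∸ gap)) % N

      -- The least label of the lift of v's component: below N, and congruent to g modulo N.
      base : Vertex F → ℕ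
      base v = (componentMin rotate v + suc gap) % N

      unwrap : Vertex F → ℕ
      unwrap v with g v ℕ.<? N
      ... | yes _ = (rotate v ∸ componentMin rotate v) + base v
      ... | no _  = g v

      unwrap-< : ∀ {v} → g v < N → unwrap v ≡ (rotate v ∸ componentMin rotate v) + base v
      unwrap-< {v} gv<N with g v ℕ.<? N
      ... | yes _   = refl
      ... | no gv≮N = ⊥-elim (gv≮N gv<N)

      unwrap-≮ : ∀ {v} → ¬ g v < N → unwrap v ≡ g v
      unwrap-≮ {v} gv≮N with g v ℕ.<? N
      ... | yes gv<N = ⊥-elim (gv≮N gv<N)
      ... | no _     = refl

      [K∸gap]+[1+gap]≡N : (K ∸ gap) + suc gap ≡ N
      [K∸gap]+[1+gap]≡N = trans (+-suc (K ∸ gap) gap) (cong suc (ℕₚ.m∸n+n≡m (ℕ.s≤s⁻¹ gap<N)))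

      rotate-recovers : ∀ {v} → g v < N → (rotate v + suc gap) % N ≡ g v
      rotate-recovers {v} gv<N = begin
        (rotate v + suc gap) % N             ≡⟨ [m%n+o]%n≡[m+o]%n {K} (g v + (K ∸ gap)) (suc gap) ⟩
        (g v + (K ∸ gap) + suc gap) % N      ≡⟨ cong (_% N) (ℕₚ.+-assoc (g v) (K ∸ gap) (suc gap)) ⟩
        (g v + ((K ∸ gap) + suc gap)) % N    ≡⟨ cong (λ x → (g v + x) % N) [K∸gap]+[1+gap]≡N ⟩
        (g v + N) % N                        ≡⟨ [m+n]%n≡m%n (g v) N ⟩
        g v % N                              ≡⟨ m<n⇒m%n≡m gv<N ⟩
        g v                                  ∎
        where open ≡-Reasoning

      rotate-step : ∀ {u v} → Respects F step g → F ∶ u ⟶ v → g u < N → rotate v ≡ suc (rotate u)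
      rotate-step {u} {v} resp u⟶v gu<N = begin
        (g v + (K ∸ gap)) % N               ≡⟨ cong (λ x → (x + (K ∸ gap)) % N)
                                                  (trans (resp u v u⟶v) (step-< gu<N)) ⟩
        (suc (g u) % N + (K ∸ gap)) % N     ≡⟨ [m%n+o]%n≡[m+o]%n {K} (suc (g u)) (K ∸ gap) ⟩
        suc (g u + (K ∸ gap)) % N           ≡⟨ suc-% {K} (g u + (K ∸ gap)) rotate≢K ⟩
        suc (rotate u)                      ∎
        where
        open ≡-Reasoning
        rotate≢K : rotate u ≢ K
        rotate≢K rotate≡K = g≢gap u (+-%-cancelʳ (K ∸ gap) gu<N gap<N (begin
          (g u + (K ∸ gap)) % N ≡⟨ rotate≡K ⟩
          K                     ≡⟨ m<n⇒m%n≡m (ℕₚ.n<1+n K) ⟨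
          K % N                 ≡⟨ cong (_% N) (ℕₚ.m+[n∸m]≡n (ℕ.s≤s⁻¹ gap<N)) ⟨
          (gap + (K ∸ gap)) % N ∎))

    module _ (small : suc (size F) < N) {g : Vertex F → ℕ} (lab : IsLabelling F M step g) where
      open Unwrap small g

      below-N-constant : ∀ {x v} → x ~ v → g x < N ⇔ g v < N
      below-N-constant = invariant-constant (_< N) <N⇔step<N (proj₂ lab)

      unwrap-preserves : IsLabelling F M suc unwrap
      unwrap-preserves = bounded , levelled
        where
        bounded : ∀ v → unwrap v ≤ M
        bounded v = go (g v ℕ.<? N)
          where
          go : Dec (g v < N) → unwrap v ≤ M
          go (yes gv<N) = subst (_≤ M) (sym (unwrap-< gv<N))
            (ℕₚ.<⇒≤ (ℕₚ.+-mono-< (ℕₚ.≤-<-trans (ℕₚ.m∸n≤m (rotate v) (componentMin rotate v))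
                                                (m%n<n (g v + (K ∸ gap)) N))
                                 (m%n<n (componentMin rotate v + suc gap) N)))
          go (no gv≮N)  = subst (_≤ M) (sym (unwrap-≮ gv≮N)) (proj₁ lab v)
        levelled : Respects F suc unwrap
        levelled i j i⟶j = go (g i ℕ.<? N)
          where
          open ≡-Reasoning
          i~j : i ~ j
          i~j = ⟶⇒~ i⟶j
          go : Dec (g i < N) → unwrap j ≡ suc (unwrap i)
          go (yes gi<N) = begin
            unwrap j                                          ≡⟨ unwrap-< (to (below-N-constant i~j) gi<N) ⟩
            (rotate j ∸ componentMin rotate j) + base j       ≡⟨ cong₂ (λ r μ → (r ∸ μ) + (μ + suc gap) % N)
                                                                   (rotate-step (proj₂ lab) i⟶j gi<N)
                                                                   (sym (componentMin-cong rotate i~j)) ⟩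
            (suc (rotate i) ∸ componentMin rotate i) + base i ≡⟨ cong (_+ base i)
                                                                   (ℕₚ.+-∸-assoc 1 (componentMin-≤-self rotate)) ⟩
            suc ((rotate i ∸ componentMin rotate i) + base i) ≡⟨ cong suc (unwrap-< gi<N) ⟨
            suc (unwrap i)                                    ∎
          go (no gi≮N) = begin
            unwrap j       ≡⟨ unwrap-≮ (λ gj<N → gi≮N (from (below-N-constant i~j) gj<N)) ⟩
            g j            ≡⟨ proj₂ lab i j i⟶j ⟩
            step (g i)     ≡⟨ step-≮ gi≮N ⟩
            suc (g i)      ≡⟨ cong suc (unwrap-≮ gi≮N) ⟨
            suc (unwrap i) ∎

      wrap-unwrap : ∀ v → wrap unwrap v ≡ g v
      wrap-unwrap v = go (g v ℕ.<? N)
        where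
        open ≡-Reasoning
        μ : Vertex F → ℕ
        μ = componentMin rotate
        go : Dec (g v < N) → wrap unwrap v ≡ g v
        go (yes gv<N) = begin
          wrap unwrap v                           ≡⟨ wrap-< (subst (_< N) (sym μ-unwrap≡base) (m%n<n (μ v + suc gap) N)) ⟩
          unwrap v % N                            ≡⟨ cong (_% N) (unwrap-< gv<N) ⟩
          ((rotate v ∸ μ v) + base v) % N         ≡⟨ [m+o%n]%n≡[m+o]%n {K} (rotate v ∸ μ v) (μ v + suc gap) ⟩
          ((rotate v ∸ μ v) + (μ v + suc gap)) % N ≡⟨ cong (_% N) (ℕₚ.+-assoc (rotate v ∸ μ v) (μ v) (suc gap)) ⟨
          ((rotate v ∸ μ v) + μ v + suc gap) % N  ≡⟨ cong (λ x → (x + suc gap) % N)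
                                                      (ℕₚ.m∸n+n≡m (componentMin-≤-self rotate)) ⟩
          (rotate v + suc gap) % N                ≡⟨ rotate-recovers gv<N ⟩
          g v                                     ∎
          where
          unwrap+μ≡rotate+base : ∀ {x} → x ~ v → unwrap x + μ v ≡ rotate x + base v
          unwrap+μ≡rotate+base {x} x~v = begin
            unwrap x + μ v                    ≡⟨ cong (_+ μ v) (unwrap-< (from (below-N-constant x~v) gv<N)) ⟩
            (rotate x ∸ μ x) + base x + μ v   ≡⟨ cong (λ m → (rotate x ∸ m) + (m + suc gap) % N + μ v)
                                                   (componentMin-cong rotate x~v) ⟩
            (rotate x ∸ μ v) + base v + μ v   ≡⟨ xy∙z≈xz∙y (rotate x ∸ μ v) (base v) (μ v) ⟩
            (rotate x ∸ μ v) + μ v + base v   ≡⟨ cong (_+ base v) (ℕₚ.m∸n+n≡m (componentMin-≤ rotate x~v)) ⟩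
            rotate x + base v                 ∎
          μ-unwrap≡base : componentMin unwrap v ≡ base v
          μ-unwrap≡base = ℕₚ.+-cancelʳ-≡ (μ v) _ _
            (trans (componentMin-shift rotate unwrap unwrap+μ≡rotate+base) (ℕₚ.+-comm (μ v) (base v)))
        go (no gv≮N) with componentMin-attained unwrap v
        ... | w , w~v , μ≡unwrap-w = trans (wrap-≮ μ≮N) (unwrap-≮ gv≮N)
          where
          gw≮N : ¬ g w < N
          gw≮N gw<N = gv≮N (to (below-N-constant w~v) gw<N)
          μ≮N : ¬ componentMin unwrap v < N
          μ≮N μ<N = gw≮N (subst (_< N) (trans μ≡unwrap-w (unwrap-≮ gw≮N)) μ<N)

    hom-CyclePlusPath≡hom-Path : suc (size F) < N → hom F CyclePlusPath ≡ hom F (Path M)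
    hom-CyclePlusPath≡hom-Path small = ℕₚ.≤-antisym
      (hom-Functional-≤ F {M} {step} {M} {suc} (Unwrap.unwrap small) (unwrap-preserves small) unwrap-injective)
      (hom-Functional-≤ F {M} {suc} {M} {step} wrap wrap-preserves wrap-injective)
      where
      unwrap-injective : ∀ {g g′} → IsLabelling F M step g → IsLabelling F M step g′ →
        (∀ v → Unwrap.unwrap small g v ≡ Unwrap.unwrap small g′ v) → ∀ v → g v ≡ g′ v
      unwrap-injective lab lab′ unwrap≗ v =
        trans (sym (wrap-unwrap small lab v)) (trans (wrap-cong unwrap≗ v) (wrap-unwrap small lab′ v))

  homs-agree : ∀ {k} (Fs : Vec Digraph k) → maxSize Fs < K →
    Vec.map (λ F → hom F CyclePlusPath) Fs ≡ Vec.map (λ F → hom F (Path M)) Fs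
  homs-agree []       _     = refl
  homs-agree (F ∷ Fs) bound = cong₂ _∷_
    (hom-CyclePlusPath≡hom-Path F (s≤s (ℕₚ.≤-<-trans (ℕₚ.m≤m⊔n (size F) (maxSize Fs)) bound)))
    (homs-agree Fs (ℕₚ.≤-<-trans (ℕₚ.m≤n⊔m (size F) (maxSize Fs)) bound))

theorem18 : Σ AdaptiveAlg (λ G → AdaptiveDecides 2 G HasDirectedCycle)
            × ((k : ℕ) → (Fs : Vec Digraph k) → (X : Vec ℕ k → Set)
               → ¬ NonAdaptiveDecides k Fs X HasDirectedCycle)
theorem18 = (cycleDetector , cycleDetector-decides) , notNonAdaptive
  where
  notNonAdaptive : (k : ℕ) (Fs : Vec Digraph k) (X : Vec ℕ k → Set) →
    ¬ NonAdaptiveDecides k Fs X HasDirectedCycle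
  notNonAdaptive k Fs X decides = Path-acyclic M (from (decides (Path M))
    (subst X (homs-agree Fs (ℕₚ.n<1+n (maxSize Fs))) (to (decides CyclePlusPath) CyclePlusPath-cyclic)))
    where open Construction (suc (maxSize Fs))
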